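{- Let $(G,T;A,B)$ be a quasicomb and $F$ a minimum join. A circuit $C$ of $G$ is $F$-balanced if and only if $w_F(C)=0$.
   Context: Graphs are finite, possibly with multiple edges. A join of $(G,T)$ is $F\subseteq E(G)$ with $|\delta_G(v)\cap F|$ odd iff $v\in T$; $\nu(G,T)$ is the minimum join size. $(G,T;A,B)$ is a bipartite graft with ordered color classes $A,B$; quasicomb: $\nu(G,T)=|B\cap T|$. $w_F(e)=-1$ for $e\in F$, $1$ otherwise; $w_F(C)$ is the sum over the edges of $C$. A circuit $C$ is $F$-balanced if $|\delta_C(v)\cap F|=1$ for every $v\in V(C)\cap B$. -}

module Defs where

open import Data.Nat using (ℕ; zero; suc; _+_; _≤_; _%_)
open import Data.Integer using (ℤ) renaming (_+_ to _+ℤ_)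
import Data.Integer as ℤ
open import Data.Fin using (Fin; zero; suc)
import Data.Fin as Fin
open import Data.Bool using (Bool; true; false; _∧_; _∨_; if_then_else_)
open import Data.Sum using (_⊎_; inj₁; inj₂)
open import Data.Product using (Σ; _×_; ∃; ∃-syntax; _,_)
open import Relation.Nullary.Decidable using (⌊_⌋)
open import Relation.Binary.PropositionalEquality using (_≡_)
open import Function.Definitions using (Injective)
open import Data.Maybe using (Maybe; just; nothing)
import Data.Maybe

count : (k : ℕ) → (Fin k → Bool) → ℕ
count zero    P = 0
count (suc k) P = (if P zero then 1 else 0) + count k (λ i → P (suc i))

sumℤ : (k : ℕ) → (Fin k → ℤ) → ℤ
sumℤ zero    f = ℤ.0ℤ
sumℤ (suc k) f = f zero +ℤ sumℤ k (λ i → f (suc i))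

bit : Bool → ℕ
bit true  = 1
bit false = 0

-- A finite bipartite multigraph with ordered colour classes A = Fin p, B = Fin q;
-- edges are Fin m, edge e joins vertex inj₁ (endA e) ∈ A with inj₂ (endB e) ∈ B.
record BipGraph : Set where
  field
    p q m : ℕ
    endA  : Fin m → Fin p
    endB  : Fin m → Fin q

open BipGraph public

Vertex : BipGraph → Set
Vertex G = Fin (p G) ⊎ Fin (q G)

incident : (G : BipGraph) → Fin (m G) → Vertex G → Bool
incident G e (inj₁ a) = ⌊ a Fin.≟ endA G e ⌋
incident G e (inj₂ b) = ⌊ b Fin.≟ endB G e ⌋

VSet EdgeSet : BipGraph → Set
VSet G = Vertex G → Bool
EdgeSet G = Fin (m G) → Bool

size : (G : BipGraph) → EdgeSet G → ℕ
size G F = count (m G) F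

sizeBT : (G : BipGraph) → VSet G → ℕ
sizeBT G T = count (q G) (λ b → T (inj₂ b))

IsJoin : (G : BipGraph) → VSet G → EdgeSet G → Set
IsJoin G T F = ∀ (v : Vertex G) →
  count (m G) (λ e → F e ∧ incident G e v) % 2 ≡ bit (T v)

IsMinJoin : (G : BipGraph) → VSet G → EdgeSet G → Set
IsMinJoin G T F = IsJoin G T F × (∀ F' → IsJoin G T F' → size G F ≤ size G F')

NuEq : (G : BipGraph) → VSet G → ℕ → Set
NuEq G T k = ∃[ F ] (IsMinJoin G T F × size G F ≡ k)

IsQuasicomb : (G : BipGraph) → VSet G → Set
IsQuasicomb G T = NuEq G T (sizeBT G T)

-- A circuit: a cyclic sequence v₀ e₀ v₁ e₁ … v_{k-1} e_{k-1} v₀ with k ≥ 2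
-- pairwise distinct vertices and pairwise distinct edges, where e_i joins
-- v_i and v_{i+1 mod k}.  (Multiple edges allowed, so k = 2 is possible.)
sucIn : {n : ℕ} → Fin n → Maybe (Fin n)
sucIn {suc zero}    zero    = nothing
sucIn {suc (suc n)} zero    = just (suc zero)
sucIn {suc (suc n)} (suc i) = Data.Maybe.map suc (sucIn i)

next : {k : ℕ} → Fin k → Fin k
next {suc k} i = Data.Maybe.fromMaybe zero (sucIn i)

record Circuit (G : BipGraph) : Set where
  field
    len    : ℕ
    len≥2  : 2 ≤ len
    vtx    : Fin len → Vertex G
    edg    : Fin len → Fin (m G)
    vtxInj : Injective _≡_ _≡_ vtx
    edgInj : Injective _≡_ _≡_ edg
    edgEnds : ∀ i → incident G (edg i) (vtx i) ≡ true × incident G (edg i) (vtx (next i)) ≡ true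

open Circuit public

wF : (G : BipGraph) → EdgeSet G → Circuit G → ℤ
wF G F C = sumℤ (len C) (λ i → if F (edg C i) then ℤ.-1ℤ else ℤ.1ℤ)

IsBalanced : (G : BipGraph) → EdgeSet G → Circuit G → Set
IsBalanced G F C = ∀ (j : Fin (len C)) (b : Fin (q G)) → vtx C j ≡ inj₂ b →
  count (len C) (λ i → F (edg C i) ∧ incident G (edg C i) (inj₂ b)) ≡ 1

-- Every edge has exactly one end in B, so |F| is the sum of the F-degrees of the
-- vertices of B.  Each of these degrees is at least |{b} ∩ T| by parity, and in a
-- quasicomb |F| = ν(G,T) = |B ∩ T|; hence every b ∈ B has F-degree |{b} ∩ T| ≤ 1.
-- Along a circuit the vertices alternate between A and B, so w_F(C) is the sum,
-- over the B-vertices of C, of the weights of their two circuit edges.  Since not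
-- both of these lie in F, each such term is 0 or 2, and it is 0 exactly when the
-- vertex meets one edge of C ∩ F.
module Submission where

open import Defs
open import Data.Integer using (0ℤ)
open import Relation.Binary.PropositionalEquality using (_≡_)
open import Function.Bundles using (_⇔_)

open import Function.Bundles using (mk⇔; Equivalence)
open import Function.Base using (_∘_)
open import Function.Properties.Equivalence using () renaming (trans to ⇔-trans; sym to ⇔-sym)
open import Data.Nat using (ℕ; zero; suc; _+_; _*_; _∸_; _≤_; z≤n; s≤s)
open import Data.Nat.Properties
  using (+-0-commutativeMonoid; ≤-refl; ≤-trans; ≤-antisym; ≤-reflexive; +-mono-≤; +-monoʳ-≤;
         +-cancelˡ-≤; +-cancelʳ-≤; m≤m+n; +-identityʳ; 1+n≢n; module ≤-Reasoning)
open import Data.Nat.DivMod using (m%n≤m)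
open import Data.Integer using (ℤ; -1ℤ; 1ℤ) renaming (+_ to pos; _+_ to _+ℤ_)
open import Data.Integer.Properties using (+-injective; pos-+)
  renaming (+-0-commutativeMonoid to ℤ-+-0-commutativeMonoid; +-identityˡ to ℤ-+-identityˡ;
            +-identityʳ to ℤ-+-identityʳ)
import Algebra.Properties.CommutativeMonoid.Sum as Summation
open import Data.Fin using (Fin; zero; suc; inject₁; fromℕ; toℕ; punchIn; punchOut; _≟_)
open import Data.Fin.Properties
  using (0≢1+n; toℕ-inject₁; punchInᵢ≢i; punchIn-injective; punchIn-punchOut)
open import Data.Fin.Permutation using (Permutation′; permutation)
open import Data.Vec.Functional using (removeAt)
open import Data.Bool using (Bool; true; false; _∧_; not; if_then_else_)
open import Data.Bool.Properties using (∧-identityʳ; ∧-conicalʳ)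
open import Data.Sum using (_⊎_; inj₁; inj₂; [_,_])
open import Data.Product using (∃; _×_; _,_; proj₁; proj₂)
open import Data.Maybe using (just; nothing)
open import Relation.Nullary using (yes; no; contradiction)
open import Relation.Binary.PropositionalEquality
  using (_≢_; refl; sym; trans; cong; cong₂; subst; module ≡-Reasoning)

open Summation +-0-commutativeMonoid using (sum-cong-≗; sum-replicate-zero; sum-remove; ∑-comm)
  renaming (sum to ∑ℕ)
open Summation ℤ-+-0-commutativeMonoid using (∑-distrib-+; sum-permute)
  renaming (sum to ∑ℤ; sum-cong-≗ to ∑ℤ-cong)

bit-if : ∀ b → (if b then 1 else 0) ≡ bit b
bit-if true  = refl
bit-if false = refl

bit≤1 : ∀ b → bit b ≤ 1
bit≤1 true  = ≤-refl
bit≤1 false = z≤n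

bit-≢true : ∀ {b} → b ≢ true → bit b ≡ 0
bit-≢true {true}  b≢true = contradiction refl b≢true
bit-≢true {false} _      = refl

∧-true : ∀ x {y} → y ≡ true → x ∧ y ≡ x
∧-true x refl = ∧-identityʳ x

count≡∑bit : ∀ k (P : Fin k → Bool) → count k P ≡ ∑ℕ (bit ∘ P)
count≡∑bit zero    P = refl
count≡∑bit (suc k) P = cong₂ _+_ (bit-if (P zero)) (count≡∑bit k (P ∘ suc))

sumℤ≡∑ : ∀ k (f : Fin k → ℤ) → sumℤ k f ≡ ∑ℤ f
sumℤ≡∑ zero    f = refl
sumℤ≡∑ (suc k) f = cong (f zero +ℤ_) (sumℤ≡∑ k (f ∘ suc))

pos-∑ : ∀ {k} (f : Fin k → ℕ) → pos (∑ℕ f) ≡ ∑ℤ (pos ∘ f)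
pos-∑ {zero}  f = refl
pos-∑ {suc k} f = trans (pos-+ (f zero) _) (cong (pos (f zero) +ℤ_) (pos-∑ (f ∘ suc)))

∑-mono-≤ : ∀ {k} {f g : Fin k → ℕ} → (∀ i → f i ≤ g i) → ∑ℕ f ≤ ∑ℕ g
∑-mono-≤ {zero}  _   = z≤n
∑-mono-≤ {suc k} f≤g = +-mono-≤ (f≤g zero) (∑-mono-≤ (f≤g ∘ suc))

≤-pointwise∧∑≥⇒≗ : ∀ {k} {f g : Fin k → ℕ} → (∀ i → f i ≤ g i) → ∑ℕ g ≤ ∑ℕ f → ∀ i → f i ≡ g i
≤-pointwise∧∑≥⇒≗ {suc k} {f} {g} f≤g ∑g≤∑f = λ where
    zero    → ≤-antisym (f≤g zero) g₀≤f₀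
    (suc i) → ≤-pointwise∧∑≥⇒≗ (f≤g ∘ suc) ∑g′≤∑f′ i
  where
  open ≤-Reasoning
  ∑f′≤∑g′ : ∑ℕ (f ∘ suc) ≤ ∑ℕ (g ∘ suc)
  ∑f′≤∑g′ = ∑-mono-≤ (f≤g ∘ suc)
  g₀≤f₀ : g zero ≤ f zero
  g₀≤f₀ = +-cancelʳ-≤ (∑ℕ (g ∘ suc)) (g zero) (f zero) (≤-trans ∑g≤∑f (+-monoʳ-≤ (f zero) ∑f′≤∑g′))
  ∑g′≤∑f′ : ∑ℕ (g ∘ suc) ≤ ∑ℕ (f ∘ suc)
  ∑g′≤∑f′ = +-cancelˡ-≤ (g zero) _ _ (≤-trans ∑g≤∑f (+-mono-≤ (f≤g zero) ≤-refl))

∑≡0⇔≗0 : ∀ {k} {f : Fin k → ℕ} → ∑ℕ f ≡ 0 ⇔ (∀ i → f i ≡ 0)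
∑≡0⇔≗0 {k} {f} = mk⇔
  (λ ∑f≡0 i → sym (≤-pointwise∧∑≥⇒≗ {f = λ _ → 0} (λ _ → z≤n)
                     (≤-trans (≤-reflexive ∑f≡0) (≤-reflexive (sym (sum-replicate-zero k)))) i))
  (λ f≗0 → trans (sum-cong-≗ f≗0) (sum-replicate-zero k))

∑-≥-at : ∀ {k} (f : Fin k → ℕ) a → f a ≤ ∑ℕ f
∑-≥-at {suc k} f a = subst (f a ≤_) (sym (sum-remove {i = a} f)) (m≤m+n (f a) _)

∑-≥-pair : ∀ {k} (f : Fin k → ℕ) {a c} → a ≢ c → f a + f c ≤ ∑ℕ f
∑-≥-pair {suc k} f {a} {c} a≢c = begin
  f a + f c                               ≡⟨ cong (λ j → f a + f j) (punchIn-punchOut a≢c) ⟨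
  f a + removeAt f a (punchOut a≢c)       ≤⟨ +-monoʳ-≤ (f a) (∑-≥-at (removeAt f a) (punchOut a≢c)) ⟩
  f a + ∑ℕ (removeAt f a)                 ≡⟨ sum-remove f ⟨
  ∑ℕ f                                    ∎
  where open ≤-Reasoning

∑-support₁ : ∀ {k} (f : Fin k → ℕ) a → (∀ i → i ≢ a → f i ≡ 0) → ∑ℕ f ≡ f a
∑-support₁ {suc k} f a f≡0 = begin
  ∑ℕ f                      ≡⟨ sum-remove f ⟩
  f a + ∑ℕ (removeAt f a)   ≡⟨ cong (f a +_) (Equivalence.from ∑≡0⇔≗0 (f≡0 _ ∘ punchInᵢ≢i a)) ⟩
  f a + 0                   ≡⟨ +-identityʳ (f a) ⟩
  f a                       ∎
  where open ≡-Reasoning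

∑-support₂ : ∀ {k} (f : Fin k → ℕ) {a c} → a ≢ c → (∀ i → i ≢ a → i ≢ c → f i ≡ 0) →
             ∑ℕ f ≡ f a + f c
∑-support₂ {suc k} f {a} {c} a≢c f≡0 = begin
  ∑ℕ f                                ≡⟨ sum-remove f ⟩
  f a + ∑ℕ (removeAt f a)             ≡⟨ cong (f a +_) (∑-support₁ (removeAt f a) (punchOut a≢c) removed≡0) ⟩
  f a + removeAt f a (punchOut a≢c)   ≡⟨ cong (λ j → f a + f j) (punchIn-punchOut a≢c) ⟩
  f a + f c                           ∎
  where
  open ≡-Reasoning
  removed≡0 : ∀ j → j ≢ punchOut a≢c → removeAt f a j ≡ 0
  removed≡0 j j≢ = f≡0 _ (punchInᵢ≢i a j)
    (λ eq → j≢ (punchIn-injective a j _ (trans eq (sym (punchIn-punchOut a≢c)))))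

count-unique : ∀ k (P : Fin k → Bool) a → (∀ i → P i ≡ true → i ≡ a) → count k P ≡ bit (P a)
count-unique k P a unique =
  trans (count≡∑bit k P) (∑-support₁ (bit ∘ P) a (λ i i≢a → bit-≢true (i≢a ∘ unique i)))

count-pair : ∀ k (P : Fin k → Bool) {a c} → a ≢ c → (∀ i → P i ≡ true → i ≡ a ⊎ i ≡ c) →
             count k P ≡ bit (P a) + bit (P c)
count-pair k P a≢c pair = trans (count≡∑bit k P) (∑-support₂ (bit ∘ P) a≢c
  (λ i i≢a i≢c → bit-≢true (λ Pi → [ i≢a , i≢c ] (pair i Pi))))

count-≥-pair : ∀ k (P : Fin k → Bool) {a c} → a ≢ c → bit (P a) + bit (P c) ≤ count k P
count-≥-pair k P a≢c = subst (_ ≤_) (sym (count≡∑bit k P)) (∑-≥-pair (bit ∘ P) a≢c)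

inject₁-or-last : ∀ {k} (i : Fin (suc k)) → (∃ λ j → i ≡ inject₁ j) ⊎ i ≡ fromℕ k
inject₁-or-last {zero}  zero    = inj₂ refl
inject₁-or-last {suc k} zero    = inj₁ (zero , refl)
inject₁-or-last {suc k} (suc i) with inject₁-or-last i
... | inj₁ (j , refl) = inj₁ (suc j , refl)
... | inj₂ refl       = inj₂ refl

sucIn-inject₁ : ∀ {k} (i : Fin (suc k)) → sucIn (inject₁ i) ≡ just (suc i)
sucIn-inject₁ {k}     zero    = refl
sucIn-inject₁ {suc k} (suc i) rewrite sucIn-inject₁ i = refl

sucIn-last : ∀ k → sucIn (fromℕ k) ≡ nothing
sucIn-last zero    = refl
sucIn-last (suc k) rewrite sucIn-last k = refl

next-inject₁ : ∀ {k} (i : Fin k) → next (inject₁ i) ≡ suc i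
next-inject₁ {suc k} i rewrite sucIn-inject₁ i = refl

next-last : ∀ k → next (fromℕ k) ≡ zero
next-last k rewrite sucIn-last k = refl

prev : ∀ {n} → Fin n → Fin n
prev {suc k} zero    = fromℕ k
prev {suc k} (suc j) = inject₁ j

next-prev : ∀ {n} (j : Fin n) → next (prev j) ≡ j
next-prev {suc k} zero    = next-last k
next-prev {suc k} (suc j) = next-inject₁ j

prev-next : ∀ {n} (i : Fin n) → prev (next i) ≡ i
prev-next {suc k} i with inject₁-or-last i
... | inj₁ (j , refl) rewrite next-inject₁ j = refl
... | inj₂ refl       rewrite next-last k     = refl

next-injective : ∀ {n} {i j : Fin n} → next i ≡ next j → i ≡ j
next-injective {i = i} {j} eq = trans (sym (prev-next i)) (trans (cong prev eq) (prev-next j))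

next-permutation : ∀ {n} → Permutation′ n
next-permutation = permutation next prev next-prev prev-next

∑-next : ∀ {n} (f : Fin n → ℤ) → ∑ℤ (f ∘ next) ≡ ∑ℤ f
∑-next f = sym (sum-permute f next-permutation)

next-≢ : ∀ {n} → 2 ≤ n → (i : Fin n) → next i ≢ i
next-≢ {suc zero}    (s≤s ()) _
next-≢ {suc (suc k)} _ i with inject₁-or-last i
... | inj₁ (j , refl) = λ eq → suc≢inject₁ (trans (sym (next-inject₁ j)) eq)
  where
  suc≢inject₁ : suc j ≢ inject₁ j
  suc≢inject₁ eq = 1+n≢n (trans (cong toℕ eq) (toℕ-inject₁ j))
... | inj₂ refl       = λ eq → 0≢1+n (trans (sym (next-last (suc k))) eq)

module _ (G : BipGraph) where

  isB : Vertex G → Bool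
  isB (inj₁ _) = false
  isB (inj₂ _) = true

  incidentᴬ : ∀ {e a} → incident G e (inj₁ a) ≡ true → a ≡ endA G e
  incidentᴬ {e} {a} h with a ≟ endA G e
  ... | yes a≡ = a≡

  incidentᴮ : ∀ {e b} → incident G e (inj₂ b) ≡ true → b ≡ endB G e
  incidentᴮ {e} {b} h with b ≟ endB G e
  ... | yes b≡ = b≡

  incident-endB : ∀ e → incident G e (inj₂ (endB G e)) ≡ true
  incident-endB e with endB G e ≟ endB G e
  ... | yes _  = refl
  ... | no ne = contradiction refl ne

  ends-alternate : ∀ {e x y} → incident G e x ≡ true → incident G e y ≡ true → x ≢ y →
                   isB y ≡ not (isB x)
  ends-alternate {x = inj₁ a} {inj₁ a′} hx hy x≢y =
    contradiction (cong inj₁ (trans (incidentᴬ hx) (sym (incidentᴬ hy)))) x≢y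
  ends-alternate {x = inj₁ a} {inj₂ b}  hx hy x≢y = refl
  ends-alternate {x = inj₂ b} {inj₁ a}  hx hy x≢y = refl
  ends-alternate {x = inj₂ b} {inj₂ b′} hx hy x≢y =
    contradiction (cong inj₂ (trans (incidentᴮ hx) (sym (incidentᴮ hy)))) x≢y

  B-end-is-an-end : ∀ {e x y b} → incident G e x ≡ true → incident G e y ≡ true → x ≢ y →
                    incident G e (inj₂ b) ≡ true → inj₂ b ≡ x ⊎ inj₂ b ≡ y
  B-end-is-an-end {x = inj₂ b′} hx hy x≢y hb =
    inj₁ (cong inj₂ (trans (incidentᴮ hb) (sym (incidentᴮ hx))))
  B-end-is-an-end {x = inj₁ a} {inj₂ b′} hx hy x≢y hb =
    inj₂ (cong inj₂ (trans (incidentᴮ hb) (sym (incidentᴮ hy))))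
  B-end-is-an-end {x = inj₁ a} {inj₁ a′} hx hy x≢y hb =
    contradiction (cong inj₁ (trans (incidentᴬ hx) (sym (incidentᴬ hy)))) x≢y

  onB : Vertex G → ℤ → ℤ
  onB (inj₁ _) z = 0ℤ
  onB (inj₂ _) z = z

  onB-split : ∀ x y → isB y ≡ not (isB x) → ∀ z → z ≡ onB y z +ℤ onB x z
  onB-split (inj₁ _) (inj₂ _) _ z = sym (ℤ-+-identityʳ z)
  onB-split (inj₂ _) (inj₁ _) _ z = sym (ℤ-+-identityˡ z)

  onB-+ : ∀ x z z′ → onB x z +ℤ onB x z′ ≡ onB x (z +ℤ z′)
  onB-+ (inj₁ _) z z′ = refl
  onB-+ (inj₂ _) z z′ = refl

  _∩δ_ : EdgeSet G → Vertex G → EdgeSet G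
  (F ∩δ v) e = F e ∧ incident G e v

  degF : EdgeSet G → Vertex G → ℕ
  degF F v = count (m G) (F ∩δ v)

  size≡∑degᴮ : ∀ F → size G F ≡ ∑ℕ (λ b → degF F (inj₂ b))
  size≡∑degᴮ F = begin
    count (m G) F                                  ≡⟨ count≡∑bit (m G) F ⟩
    ∑ℕ (λ e → bit (F e))                           ≡⟨ sum-cong-≗ (λ e → sym (countᴮ≡bitF e)) ⟩
    ∑ℕ (λ e → count (q G) (Fᴮ e))                  ≡⟨ sum-cong-≗ (λ e → count≡∑bit (q G) (Fᴮ e)) ⟩
    ∑ℕ (λ e → ∑ℕ (λ b → bit (Fᴮ e b)))             ≡⟨ ∑-comm (λ e b → bit (Fᴮ e b)) ⟩
    ∑ℕ (λ b → ∑ℕ (λ e → bit (Fᴮ e b)))             ≡⟨ sum-cong-≗ (λ b → sym (count≡∑bit (m G) (λ e → Fᴮ e b))) ⟩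
    ∑ℕ (λ b → degF F (inj₂ b))                     ∎
    where
    open ≡-Reasoning
    Fᴮ : Fin (m G) → Fin (q G) → Bool
    Fᴮ e b = (F ∩δ inj₂ b) e
    countᴮ≡bitF : ∀ e → count (q G) (Fᴮ e) ≡ bit (F e)
    countᴮ≡bitF e = trans (count-unique (q G) (Fᴮ e) (endB G e) (λ b h → incidentᴮ (∧-conicalʳ _ _ h)))
                          (cong bit (∧-true (F e) (incident-endB e)))

  join⇒bit≤degF : ∀ {T F} → IsJoin G T F → ∀ v → bit (T v) ≤ degF F v
  join⇒bit≤degF {F = F} join v = subst (_≤ degF F v) (join v) (m%n≤m (degF F v) 2)

  quasicomb-degᴮ≡bit : ∀ {T F} → IsQuasicomb G T → IsMinJoin G T F →
                      ∀ b → degF F (inj₂ b) ≡ bit (T (inj₂ b))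
  quasicomb-degᴮ≡bit {T} {F} (F₀ , (join₀ , _) , |F₀|≡|B∩T|) (join , minimal) b =
    sym (≤-pointwise∧∑≥⇒≗ (join⇒bit≤degF join ∘ inj₂) ∑deg≤∑T b)
    where
    open ≤-Reasoning
    ∑deg≤∑T : ∑ℕ (λ b → degF F (inj₂ b)) ≤ ∑ℕ (λ b → bit (T (inj₂ b)))
    ∑deg≤∑T = begin
      ∑ℕ (λ b → degF F (inj₂ b))   ≡⟨ size≡∑degᴮ F ⟨
      size G F                     ≤⟨ minimal F₀ join₀ ⟩
      size G F₀                    ≡⟨ |F₀|≡|B∩T| ⟩
      sizeBT G T                   ≡⟨ count≡∑bit (q G) (T ∘ inj₂) ⟩
      ∑ℕ (λ b → bit (T (inj₂ b)))  ∎

  quasicomb-degᴮ≤1 : ∀ {T F} → IsQuasicomb G T → IsMinJoin G T F → ∀ b → degF F (inj₂ b) ≤ 1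
  quasicomb-degᴮ≤1 qc mj b = subst (_≤ 1) (sym (quasicomb-degᴮ≡bit qc mj b)) (bit≤1 _)

weight : Bool → ℤ
weight x = if x then -1ℤ else 1ℤ

weight-pair : ∀ x y → bit x + bit y ≤ 1 → weight x +ℤ weight y ≡ pos (2 * (1 ∸ (bit x + bit y)))
weight-pair true  true  (s≤s ())
weight-pair true  false _ = refl
weight-pair false true  _ = refl
weight-pair false false _ = refl

module CircuitBalance (G : BipGraph) (F : EdgeSet G)
                      (degᴮ≤1 : ∀ b → degF G F (inj₂ b) ≤ 1) (C : Circuit G) where

  private
    L = len C
    v = vtx C
    e = edg C

  Fᵇ : Fin (q G) → EdgeSet G
  Fᵇ b = _∩δ_ G F (inj₂ b)

  -- the F-degree in C of the vertex v (next i), whose circuit edges are e i and e (next i)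
  degC : Fin L → ℕ
  degC i = bit (F (e i)) + bit (F (e (next i)))

  DegreesOne : Set
  DegreesOne = ∀ i b → v (next i) ≡ inj₂ b → degC i ≡ 1

  next≢ : ∀ i → next i ≢ i
  next≢ = next-≢ (len≥2 C)

  alternates : ∀ i → isB G (v (next i)) ≡ not (isB G (v i))
  alternates i = ends-alternate G (proj₁ (edgEnds C i)) (proj₂ (edgEnds C i))
                   (λ eq → next≢ i (sym (vtxInj C eq)))

  incident-around : ∀ {i b} → v (next i) ≡ inj₂ b →
                    incident G (e i) (inj₂ b) ≡ true × incident G (e (next i)) (inj₂ b) ≡ true
  incident-around {i} vb = subst (λ x → incident G (e i) x ≡ true) vb (proj₂ (edgEnds C i))
                         , subst (λ x → incident G (e (next i)) x ≡ true) vb (proj₁ (edgEnds C (next i)))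

  Fᵇ-around : ∀ {i b} → v (next i) ≡ inj₂ b → bit (Fᵇ b (e i)) + bit (Fᵇ b (e (next i))) ≡ degC i
  Fᵇ-around {i} vb = cong₂ (λ x y → bit x + bit y) (∧-true (F (e i)) (proj₁ (incident-around vb)))
                                                  (∧-true (F (e (next i))) (proj₂ (incident-around vb)))

  circuit-edges-at : ∀ {i j b} → v j ≡ inj₂ b → incident G (e i) (inj₂ b) ≡ true → j ≡ i ⊎ j ≡ next i
  circuit-edges-at {i} vj hb with B-end-is-an-end G (proj₁ (edgEnds C i)) (proj₂ (edgEnds C i))
                                     (λ eq → next≢ i (sym (vtxInj C eq))) hb
  ... | inj₁ b≡vi  = inj₁ (vtxInj C (trans vj b≡vi))
  ... | inj₂ b≡vi′ = inj₂ (vtxInj C (trans vj b≡vi′))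

  countC-around : ∀ {i b} → v (next i) ≡ inj₂ b → count L (Fᵇ b ∘ e) ≡ degC i
  countC-around {i} {b} vb = trans (count-pair L (Fᵇ b ∘ e) (λ eq → next≢ i (sym eq)) around) (Fᵇ-around vb)
    where
    around : ∀ i′ → Fᵇ b (e i′) ≡ true → i′ ≡ i ⊎ i′ ≡ next i
    around i′ h with circuit-edges-at vb (∧-conicalʳ _ _ h)
    ... | inj₁ next-i≡i′   = inj₂ (sym next-i≡i′)
    ... | inj₂ next-i≡next = inj₁ (sym (next-injective next-i≡next))

  degC≤1 : ∀ {i b} → v (next i) ≡ inj₂ b → degC i ≤ 1
  degC≤1 {i} {b} vb = begin
    degC i                                         ≡⟨ Fᵇ-around vb ⟨
    bit (Fᵇ b (e i)) + bit (Fᵇ b (e (next i)))     ≤⟨ count-≥-pair (m G) (Fᵇ b) (λ eq → next≢ i (sym (edgInj C eq))) ⟩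
    degF G F (inj₂ b)                              ≤⟨ degᴮ≤1 b ⟩
    1                                              ∎
    where open ≤-Reasoning

  balanced⇔degreesOne : IsBalanced G F C ⇔ DegreesOne
  balanced⇔degreesOne = mk⇔
    (λ balanced i b vb → trans (sym (countC-around vb)) (balanced (next i) b vb))
    (λ one j b vj → let vb = trans (cong v (next-prev j)) vj in
                    trans (countC-around vb) (one (prev j) b vb))

  defectAt : Vertex G → ℕ → ℕ
  defectAt (inj₁ _) c = 0
  defectAt (inj₂ _) c = 2 * (1 ∸ c)

  defect : Fin L → ℕ
  defect i = defectAt (v (next i)) (degC i)

  weight-around : ∀ i → onB G (v (next i)) (weight (F (e i)) +ℤ weight (F (e (next i)))) ≡ pos (defect i)
  weight-around i with v (next i) in vb
  ... | inj₁ _ = refl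
  ... | inj₂ _ = weight-pair (F (e i)) (F (e (next i))) (degC≤1 vb)

  wF≡∑defect : wF G F C ≡ pos (∑ℕ defect)
  wF≡∑defect = begin
    sumℤ L w                                       ≡⟨ sumℤ≡∑ L w ⟩
    ∑ℤ w                                           ≡⟨ ∑ℤ-cong (λ i → onB-split G (v i) (v (next i)) (alternates i) (w i)) ⟩
    ∑ℤ (λ i → atNext i +ℤ atSelf i)                ≡⟨ ∑-distrib-+ atNext atSelf ⟩
    ∑ℤ atNext +ℤ ∑ℤ atSelf                         ≡⟨ cong (∑ℤ atNext +ℤ_) (∑-next atSelf) ⟨
    ∑ℤ atNext +ℤ ∑ℤ (atSelf ∘ next)                ≡⟨ ∑-distrib-+ atNext (atSelf ∘ next) ⟨
    ∑ℤ (λ i → atNext i +ℤ atSelf (next i))         ≡⟨ ∑ℤ-cong (λ i → trans (onB-+ G (v (next i)) _ _) (weight-around i)) ⟩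
    ∑ℤ (pos ∘ defect)                              ≡⟨ pos-∑ defect ⟨
    pos (∑ℕ defect)                                ∎
    where
    open ≡-Reasoning
    w atSelf atNext : Fin L → ℤ
    w i = weight (F (e i))
    atSelf i = onB G (v i) (w i)
    atNext i = onB G (v (next i)) (w i)

  defect≡0⇔ : ∀ i → defect i ≡ 0 ⇔ (∀ b → v (next i) ≡ inj₂ b → degC i ≡ 1)
  defect≡0⇔ i with v (next i) | degC i | degC≤1 {i}
  ... | inj₁ _ | _           | _ = mk⇔ (λ _ _ ()) (λ _ → refl)
  ... | inj₂ b | zero        | _ = mk⇔ (λ ()) (λ one → contradiction (one b refl) (λ ()))
  ... | inj₂ b | suc zero    | _ = mk⇔ (λ _ _ _ → refl) (λ _ → refl)
  ... | inj₂ b | suc (suc _) | ≤1 = contradiction (≤1 refl) (λ where (s≤s ()))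

  weight≡0⇔degreesOne : wF G F C ≡ 0ℤ ⇔ DegreesOne
  weight≡0⇔degreesOne = mk⇔
    (λ w≡0 i → Equivalence.to (defect≡0⇔ i)
                 (Equivalence.to ∑≡0⇔≗0 (+-injective (trans (sym wF≡∑defect) w≡0)) i))
    (λ one → trans wF≡∑defect (cong pos (Equivalence.from ∑≡0⇔≗0 (λ i → Equivalence.from (defect≡0⇔ i) (one i)))))

lemma7p6 : (G : BipGraph) (T : VSet G) (F : EdgeSet G) →
    IsQuasicomb G T → IsMinJoin G T F →
    (C : Circuit G) → IsBalanced G F C ⇔ (wF G F C ≡ 0ℤ)
lemma7p6 G T F qc mj C = ⇔-trans balanced⇔degreesOne (⇔-sym weight≡0⇔degreesOne)
  where open CircuitBalance G F (quasicomb-degᴮ≤1 G qc mj) C
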